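{- For a weak composition $a$ of length $n$, $$\lim_{m\to\infty}\mathfrak{M}_{0^m\times a}=M_{\mathrm{flat}(a)}(X),\qquad \lim_{m\to\infty}\mathfrak{F}_{0^m\times a}=F_{\mathrm{flat}(a)}(X),$$ where the limits are taken coefficientwise in $\mathbb{Z}[[x_1,x_2,\dots]]$.
   Context: $0^m\times a=(0,\dots,0,a_1,\dots,a_n)$ is the weak composition of length $n+m$ obtained by prepending $m$ zeros. $\mathrm{flat}(a)$ deletes zero entries; for weak compositions of length $N$, $b\ge a$ means $b_1+\dots+b_i\ge a_1+\dots+a_i$ for all $i$; a composition $\beta$ refines $\alpha$ if $\alpha$ is obtained by summing consecutive blocks of parts of $\beta$. For a weak composition $a$ of length $N$: $\mathfrak{M}_a=\sum x_1^{b_1}\cdots x_N^{b_N}$ over weak compositions $b$ of length $N$ with $b\ge a$, $\mathrm{flat}(b)=\mathrm{flat}(a)$; $\mathfrak{F}_a$ is the same sum over $b\ge a$ with $\mathrm{flat}(b)$ refining $\mathrm{flat}(a)$. For a composition $\alpha$ of length $\ell$, $M_\alpha(X)=\sum_{i_1<\dots<i_\ell}x_{i_1}^{\alpha_1}\cdots x_{i_\ell}^{\alpha_\ell}$ (indices in positive integers) and $F_\alpha(X)=\sum_{\beta\text{ refines }\alpha}M_\beta(X)$. -}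

module Defs where

open import Data.Nat using (ℕ; zero; suc; _+_; _∸_; _≤_; _<_; _≟_; _≤?_; _<?_)
open import Data.List using (List; []; _∷_; _++_; map; concatMap; filter; take; length;
  replicate; upTo; reverse; dropWhile; foldr; zipWith; _∷ʳ_)
open import Data.Nat.ListAction using (sum)
open import Data.List.Properties using (≡-dec)
open import Data.List.Relation.Unary.All using (All; all?)
open import Data.List.Membership.DecPropositional (≡-dec _≟_) using (_∈_; _∈?_)
open import Data.Product using (_×_)
open import Relation.Nullary using (¬?)
open import Relation.Nullary.Decidable using (_×-dec_)
open import Relation.Binary.PropositionalEquality using (_≡_)

-- Weak compositions, compositions and exponent vectors are lists of naturals.
-- An exponent vector c = (c₁,…,c_L) stands for the monomial x₁^c₁ ⋯ x_L^c_L ;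
-- trailing zeros are irrelevant.

_≟ₗ_ : (u v : List ℕ) → Relation.Nullary.Dec (u ≡ v)
_≟ₗ_ = ≡-dec _≟_

trim : List ℕ → List ℕ
trim c = reverse (dropWhile (λ x → x ≟ 0) (reverse c))

zeros×_ : ℕ → List ℕ → List ℕ
(zeros× m) a = replicate m 0 ++ a

flat : List ℕ → List ℕ
flat = filter (λ x → ¬? (x ≟ 0))

wcomps : ℕ → ℕ → List (List ℕ)
wcomps zero zero = [] ∷ []
wcomps zero (suc k) = []
wcomps (suc N) k = concatMap (λ i → map (i ∷_) (wcomps N (k ∸ i))) (upTo (suc k))

Dom : List ℕ → List ℕ → Set
Dom b a = All (λ i → sum (take i a) ≤ sum (take i b)) (upTo (suc (length b)))

dom? : (b a : List ℕ) → Relation.Nullary.Dec (Dom b a)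
dom? b a = all? (λ i → sum (take i a) ≤? sum (take i b)) (upTo (suc (length b)))

-- compositions of p (positive parts summing to p; such have length ≤ p)
comps : ℕ → List (List ℕ)
comps p = filter (all? (λ x → 0 <? x)) (concatMap (λ L → wcomps L p) (upTo (suc p)))

-- all refinements of α : β refines α iff β = γ₁ ++ ⋯ ++ γ_ℓ with γᵢ a composition of αᵢ
-- (i.e. α is obtained from β by summing consecutive blocks of parts)
refinementsOf : List ℕ → List (List ℕ)
refinementsOf [] = [] ∷ []
refinementsOf (p ∷ α) = concatMap (λ γ → map (γ ++_) (refinementsOf α)) (comps p)

Refines : List ℕ → List ℕ → Set
Refines β α = β ∈ refinementsOf α

refines? : (β α : List ℕ) → Relation.Nullary.Dec (Refines β α)
refines? β α = β ∈? refinementsOf α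

-- A polynomial with nonnegative integer coefficients given as a formal sum
-- (list, with multiplicity) of monomials; its coefficient at the monomial x^c.
coeff : List (List ℕ) → List ℕ → ℕ
coeff P c = length (filter (λ b → trim b ≟ₗ trim c) P)

-- 𝔐_a = Σ_{b ≥ a, flat b = flat a} x^b   (b weak composition of length N = length a;
-- flat b = flat a forces sum b = sum a, so b ranges over wcomps N (sum a))
𝔐 : List ℕ → List (List ℕ)
𝔐 a = filter (λ b → dom? b a ×-dec (flat b ≟ₗ flat a)) (wcomps (length a) (sum a))

-- 𝔉_a = Σ_{b ≥ a, flat b refines flat a} x^b  (refinement again forces sum b = sum a)
𝔉 : List ℕ → List (List ℕ)
𝔉 a = filter (λ b → dom? b a ×-dec refines? (flat b) (flat a)) (wcomps (length a) (sum a))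

-- pointwise sum of exponent vectors (= product of monomials)
_⊕_ : List ℕ → List ℕ → List ℕ
[] ⊕ v = v
(x ∷ u) ⊕ [] = x ∷ u
(x ∷ u) ⊕ (y ∷ v) = (x + y) ∷ (u ⊕ v)

-- exponent vector of x_i^e  (i ≥ 1)
varPow : ℕ → ℕ → List ℕ
varPow i e = replicate (i ∸ 1) 0 ∷ʳ e

monoOf : List ℕ → List ℕ → List ℕ
monoOf is α = foldr _⊕_ [] (zipWith varPow is α)

incr : ℕ → ℕ → List (List ℕ)
incr zero zero = [] ∷ []
incr zero (suc ℓ) = []
incr (suc L) zero = incr L zero
incr (suc L) (suc ℓ) = incr L (suc ℓ) ++ map (_∷ʳ suc L) (incr L ℓ)

-- coefficient of x^c in M_α(X) = Σ_{i₁<⋯<i_ℓ} x_{i₁}^{α₁}⋯x_{i_ℓ}^{α_ℓ}.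
-- Since α has positive parts, only index tuples with i_ℓ ≤ length c can produce x^c.
coeffM : List ℕ → List ℕ → ℕ
coeffM α c = coeff (map (λ is → monoOf is α) (incr (length c) (length α))) c

coeffF : List ℕ → List ℕ → ℕ
coeffF α c = sum (map (λ β → coeffM β c) (refinementsOf α))

-- The coefficient of x^c in 𝔐_b (resp. 𝔉_b) is 1 exactly when the padding c′ of c by zeros to the length of b
-- satisfies c′ ≥ b and flat c = flat b (resp. flat c refines flat b), since every weak composition of given length
-- and sum is listed exactly once.  For b = 0^m × a with m ≥ length c the dominance c′ ≥ b is automatic: the first
-- m partial sums of b vanish, and after position m the partial sums of c′ already equal sum c.  On the other side,
-- the coefficient of x^c in M_α is [flat c = α], by induction on the number of variables, splitting M_α according
-- to the exponent of the last variable; and that of F_α counts flat c among the refinements of α, which are pairwise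
-- distinct.  So both coefficients are constant from m₀ = length c on.
module Submission where

open import Defs
open import Data.Empty using (⊥-elim)
open import Data.List using (List; []; _∷_; [_]; _++_; head; _∷ʳ_; map; concatMap; filter; length; replicate;
  reverse; dropWhile; foldr; zipWith; take; upTo; initLast; _∷ʳ′_)
open import Data.List.Properties using (length-++; length-replicate; length-filter; filter-++; filter-some;
  filter-none; map-++; map-∘; map-cong-local; concatMap-pure; ++-assoc; ++-identityʳ; ++-cancelˡ;
  ∷-injectiveʳ; ∷ʳ-injectiveˡ; ∷ʳ-injectiveʳ; reverse-++; reverse-involutive; unfold-reverse; foldr-++)
open import Data.List.Membership.Propositional using (_∈_; _∉_)
open import Data.List.Membership.Propositional.Properties using (∈-map⁻; ∈-upTo⁺; ∈-upTo⁻)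
open import Data.List.Relation.Unary.All as All using (All; []; _∷_; all?)
import Data.List.Relation.Unary.All.Properties as All
open import Data.List.Relation.Unary.Any using (here; there)
open import Data.List.Relation.Unary.Unique.Propositional using (Unique; []; _∷_)
open import Data.List.Relation.Unary.Unique.Propositional.Properties using (upTo⁺)
open import Data.Nat as ℕ using (ℕ; zero; suc; _+_; _*_; _∸_; _≤_; _<_; z≤n; s≤s; _≟_)
open import Data.Nat.Properties
open import Data.Nat.ListAction using (sum)
open import Data.Nat.ListAction.Properties using (sum-++)
open import Data.Product using (Σ; ∃; _×_; _,_; proj₁; proj₂; map₂)
open import Data.Maybe using (fromMaybe)
open import Function using (_∘_; _⇔_; mk⇔; Equivalence)
open import Relation.Binary.Definitions using (DecidableEquality)
open import Relation.Binary.PropositionalEquality hiding ([_])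
open import Relation.Nullary using (Dec; does; yes; no; ¬_)
open import Data.Bool using (true; false)
open import Relation.Nullary.Decidable using (_×-dec_)
open import Relation.Unary using (Decidable)

-- Counting and multiplicities

length-filter-++ : ∀ {A : Set} {P : A → Set} (P? : Decidable P) xs ys →
  length (filter P? (xs ++ ys)) ≡ length (filter P? xs) + length (filter P? ys)
length-filter-++ P? xs ys = trans (cong length (filter-++ P? xs ys)) (length-++ (filter P? xs))

length-filter-map : ∀ {A B : Set} {P : B → Set} (P? : Decidable P) (f : A → B) xs →
  length (filter P? (map f xs)) ≡ length (filter (P? ∘ f) xs)
length-filter-map P? f [] = refl
length-filter-map P? f (x ∷ xs) with does (P? (f x))
... | true = cong suc (length-filter-map P? f xs)
... | false = length-filter-map P? f xs

length-filter-concatMap : ∀ {A B : Set} {P : B → Set} (P? : Decidable P) (f : A → List B) xs →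
  length (filter P? (concatMap f xs)) ≡ sum (map (λ x → length (filter P? (f x))) xs)
length-filter-concatMap P? f [] = refl
length-filter-concatMap P? f (x ∷ xs) =
  trans (length-filter-++ P? (f x) (concatMap f xs))
        (cong (length (filter P? (f x)) +_) (length-filter-concatMap P? f xs))

length-filter-cong : ∀ {A : Set} {P Q : A → Set} (P? : Decidable P) (Q? : Decidable Q) {xs} →
  All (λ x → P x ⇔ Q x) xs → length (filter P? xs) ≡ length (filter Q? xs)
length-filter-cong P? Q? [] = refl
length-filter-cong P? Q? {x ∷ xs} (P⇔Q ∷ rest) with P? x | Q? x
... | yes _ | yes _ = cong suc (length-filter-cong P? Q? rest)
... | no _ | no _ = length-filter-cong P? Q? rest
... | yes p | no ¬q = ⊥-elim (¬q (Equivalence.to P⇔Q p))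
... | no ¬p | yes q = ⊥-elim (¬p (Equivalence.from P⇔Q q))

module Multiplicity {A : Set} (_≟_ : DecidableEquality A) where

  open import Data.List.Membership.DecPropositional _≟_ using (_∈?_)

  occ : A → List A → ℕ
  occ v xs = length (filter (v ≟_) xs)

  occ-∈ : ∀ {v xs} → v ∈ xs → 0 < occ v xs
  occ-∈ {v} = filter-some (v ≟_)

  occ-∉ : ∀ {v xs} → v ∉ xs → occ v xs ≡ 0
  occ-∉ {v} {xs} v∉xs = cong length (filter-none (v ≟_) (All.¬Any⇒All¬ xs v∉xs))

  occ>0⇒∈ : ∀ {v xs} → 0 < occ v xs → v ∈ xs
  occ>0⇒∈ {v} {xs} occ>0 with v ∈? xs
  ... | yes v∈xs = v∈xs
  ... | no v∉xs = ⊥-elim (<-irrefl (sym (occ-∉ v∉xs)) occ>0)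

  occ-≤1-from-members : ∀ {xs} → (∀ {w} → w ∈ xs → occ w xs ≤ 1) → ∀ v → occ v xs ≤ 1
  occ-≤1-from-members {xs} members-≤1 v with v ∈? xs
  ... | yes v∈xs = members-≤1 v∈xs
  ... | no v∉xs = ≤-trans (≤-reflexive (occ-∉ v∉xs)) z≤n

  occ-unique : ∀ {v xs} → Unique xs → v ∈ xs → occ v xs ≡ 1
  occ-unique {v} {x ∷ xs} (x∉xs ∷ unique) v∈ with v ≟ x
  ... | yes refl = cong suc (occ-∉ (λ v∈xs → All.lookup x∉xs v∈xs refl))
  ... | no v≢x with v∈
  ...   | here v≡x = ⊥-elim (v≢x v≡x)
  ...   | there v∈xs = occ-unique unique v∈xs

  occ-unique-≤1 : ∀ {xs} → Unique xs → ∀ v → occ v xs ≤ 1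
  occ-unique-≤1 unique = occ-≤1-from-members (λ w∈xs → ≤-reflexive (occ-unique unique w∈xs))

  occ-[-]-≡ : ∀ v w → v ≡ w → occ v [ w ] ≡ 1
  occ-[-]-≡ v .v refl = occ-unique ([] ∷ []) (here refl)

  occ-[-]-≢ : ∀ v w → v ≢ w → occ v [ w ] ≡ 0
  occ-[-]-≢ v w v≢w = occ-∉ {xs = [ w ]} λ { (here v≡w) → v≢w v≡w }

  occ-filter-accept : ∀ {P : A → Set} (P? : Decidable P) {v} xs → P v → occ v (filter P? xs) ≡ occ v xs
  occ-filter-accept P? [] pv = refl
  occ-filter-accept P? {v} (x ∷ xs) pv with P? x
  ... | yes _ with v ≟ x
  ...   | yes _ = cong suc (occ-filter-accept P? xs pv)
  ...   | no _ = occ-filter-accept P? xs pv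
  occ-filter-accept P? {v} (x ∷ xs) pv | no ¬px with v ≟ x
  ...   | yes refl = ⊥-elim (¬px pv)
  ...   | no _ = occ-filter-accept P? xs pv

  occ-filter-reject : ∀ {P : A → Set} (P? : Decidable P) {v} xs → ¬ P v → occ v (filter P? xs) ≡ 0
  occ-filter-reject P? [] ¬pv = refl
  occ-filter-reject P? {v} (x ∷ xs) ¬pv with P? x
  ... | no _ = occ-filter-reject P? xs ¬pv
  ... | yes px with v ≟ x
  ...   | yes refl = ⊥-elim (¬pv px)
  ...   | no _ = occ-filter-reject P? xs ¬pv

  occ-filter-≤ : ∀ {P : A → Set} (P? : Decidable P) v xs → occ v (filter P? xs) ≤ occ v xs
  occ-filter-≤ P? v xs with P? v
  ... | yes pv = ≤-reflexive (occ-filter-accept P? xs pv)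
  ... | no ¬pv = ≤-trans (≤-reflexive (occ-filter-reject P? xs ¬pv)) z≤n

  occ-map-injective : (f : A → A) → (∀ {x y} → f x ≡ f y → x ≡ y) → ∀ v xs → occ (f v) (map f xs) ≡ occ v xs
  occ-map-injective f injective v xs =
    trans (length-filter-map (f v ≟_) f xs)
          (length-filter-cong _ _ (All.universal (λ _ → mk⇔ injective (cong f)) xs))

  occ-map-outside : (f : A → A) → ∀ {v} → (∀ x → f x ≢ v) → ∀ xs → occ v (map f xs) ≡ 0
  occ-map-outside f outside xs = occ-∉ {xs = map f xs} λ v∈ →
    let (x , _ , v≡fx) = ∈-map⁻ f v∈ in outside x (sym v≡fx)

  occ-map-≤1 : (f : A → A) → (∀ {x y} → f x ≡ f y → x ≡ y) → ∀ {xs} → (∀ w → occ w xs ≤ 1) →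
    ∀ v → occ v (map f xs) ≤ 1
  occ-map-≤1 f injective {xs} xs-≤1 = occ-≤1-from-members member-≤1
    where
    member-≤1 : ∀ {v} → v ∈ map f xs → occ v (map f xs) ≤ 1
    member-≤1 v∈ with ∈-map⁻ f v∈
    ... | w , _ , refl = ≤-trans (≤-reflexive (occ-map-injective f injective w xs)) (xs-≤1 w)

  sum-map-supported : (g : A → ℕ) (t : A) (xs : List A) → All (λ x → 0 < g x → t ≡ x) xs →
    sum (map g xs) ≡ occ t xs * g t
  sum-map-supported g t [] [] = refl
  sum-map-supported g t (x ∷ xs) (supp ∷ supps) with t ≟ x
  ... | yes refl = cong (g t +_) (sum-map-supported g t xs supps)
  ... | no t≢x = trans (cong (_+ sum (map g xs)) (n≤0⇒n≡0 (≮⇒≥ (t≢x ∘ supp))))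
                       (sum-map-supported g t xs supps)

occ-concatMap-tagged : ∀ {A B : Set} (_≟ᴬ_ : DecidableEquality A) (_≟ᴮ_ : DecidableEquality B)
  (tag : B → A) (f : A → List B) (xs : List A) → All (λ x → All (λ y → tag y ≡ x) (f x)) xs → ∀ v →
  Multiplicity.occ _≟ᴮ_ v (concatMap f xs) ≡
  Multiplicity.occ _≟ᴬ_ (tag v) xs * Multiplicity.occ _≟ᴮ_ v (f (tag v))
occ-concatMap-tagged _≟ᴬ_ _≟ᴮ_ tag f xs tagged v =
  trans (length-filter-concatMap (v ≟ᴮ_) f xs)
        (Multiplicity.sum-map-supported _≟ᴬ_ (λ x → occ v (f x)) (tag v) xs
          (All.map (λ tags occ>0 → All.lookup tags (occ>0⇒∈ occ>0)) tagged))
  where open Multiplicity _≟ᴮ_ using (occ; occ>0⇒∈)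

open Multiplicity _≟ₗ_
module ℕ-Multiplicity = Multiplicity ℕ._≟_

-- Trailing zeros, padding and flattening

replicate-∷ʳ : ∀ {A : Set} k (x : A) → replicate k x ∷ʳ x ≡ replicate (suc k) x
replicate-∷ʳ zero x = refl
replicate-∷ʳ (suc k) x = cong (x ∷_) (replicate-∷ʳ k x)

reverse-replicate : ∀ {A : Set} k (x : A) → reverse (replicate k x) ≡ replicate k x
reverse-replicate zero x = refl
reverse-replicate (suc k) x = begin
  reverse (x ∷ replicate k x)  ≡⟨ unfold-reverse x (replicate k x) ⟩
  reverse (replicate k x) ∷ʳ x ≡⟨ cong (_∷ʳ x) (reverse-replicate k x) ⟩
  replicate k x ∷ʳ x           ≡⟨ replicate-∷ʳ k x ⟩
  replicate (suc k) x          ∎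
  where open ≡-Reasoning

length-∷ʳ : ∀ {A : Set} (xs : List A) x → length (xs ∷ʳ x) ≡ suc (length xs)
length-∷ʳ xs x = trans (length-++ xs) (+-comm (length xs) 1)

∷ʳ≢[] : ∀ {A : Set} (xs : List A) x → xs ∷ʳ x ≢ []
∷ʳ≢[] [] x ()
∷ʳ≢[] (_ ∷ _) x ()

zipWith-∷ʳ : ∀ {A B C : Set} (f : A → B → C) xs ys x y → length xs ≡ length ys →
  zipWith f (xs ∷ʳ x) (ys ∷ʳ y) ≡ zipWith f xs ys ∷ʳ f x y
zipWith-∷ʳ f [] [] x y _ = refl
zipWith-∷ʳ f (x′ ∷ xs) (y′ ∷ ys) x y |xs|≡|ys| =
  cong (f x′ y′ ∷_) (zipWith-∷ʳ f xs ys x y (suc-injective |xs|≡|ys|))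
zipWith-∷ʳ f [] (_ ∷ _) x y ()
zipWith-∷ʳ f (_ ∷ _) [] x y ()

dropZeros : List ℕ → List ℕ
dropZeros = dropWhile (λ x → x ≟ 0)

dropZeros-++ : ∀ k r → dropZeros (replicate k 0 ++ r) ≡ dropZeros r
dropZeros-++ zero r = refl
dropZeros-++ (suc k) r = dropZeros-++ k r

dropZeros-split : ∀ r → ∃ λ k → r ≡ replicate k 0 ++ dropZeros r
dropZeros-split [] = 0 , refl
dropZeros-split (zero ∷ r) = let k , r≡ = dropZeros-split r in suc k , cong (0 ∷_) r≡
dropZeros-split (suc x ∷ r) = 0 , refl

trim-++-zeros : ∀ u k → trim (u ++ replicate k 0) ≡ trim u
trim-++-zeros u k = cong reverse (begin
  dropZeros (reverse (u ++ replicate k 0))             ≡⟨ cong dropZeros (reverse-++ u (replicate k 0)) ⟩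
  dropZeros (reverse (replicate k 0) ++ reverse u)     ≡⟨ cong (λ r → dropZeros (r ++ reverse u)) (reverse-replicate k 0) ⟩
  dropZeros (replicate k 0 ++ reverse u)               ≡⟨ dropZeros-++ k (reverse u) ⟩
  dropZeros (reverse u)                                ∎)
  where open ≡-Reasoning

trim-split : ∀ u → ∃ λ k → u ≡ trim u ++ replicate k 0
trim-split u = k , (begin
  u                                              ≡⟨ reverse-involutive u ⟨
  reverse (reverse u)                            ≡⟨ cong reverse r≡ ⟩
  reverse (replicate k 0 ++ dropZeros (reverse u)) ≡⟨ reverse-++ (replicate k 0) _ ⟩
  trim u ++ reverse (replicate k 0)              ≡⟨ cong (trim u ++_) (reverse-replicate k 0) ⟩
  trim u ++ replicate k 0                        ∎)
  where
  open ≡-Reasoning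
  k = proj₁ (dropZeros-split (reverse u))
  r≡ = proj₂ (dropZeros-split (reverse u))

trim-injective : ∀ u v → length u ≡ length v → trim u ≡ trim v → u ≡ v
trim-injective u v |u|≡|v| tu≡tv with trim-split u | trim-split v
... | k , u≡ | l , v≡ = trans u≡ (trans (cong₂ _++_ tu≡tv (cong (λ n → replicate n 0) k≡l)) (sym v≡))
  where
  length-split : ∀ w n → length (w ++ replicate n 0) ≡ length w + n
  length-split w n = trans (length-++ w) (cong (length w +_) (length-replicate n))
  k≡l : k ≡ l
  k≡l = +-cancelˡ-≡ (length (trim v)) k l (begin
    length (trim v) + k           ≡⟨ cong (λ t → length t + k) tu≡tv ⟨
    length (trim u) + k           ≡⟨ length-split (trim u) k ⟨
    length (trim u ++ replicate k 0) ≡⟨ cong length u≡ ⟨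
    length u                      ≡⟨ |u|≡|v| ⟩
    length v                      ≡⟨ cong length v≡ ⟩
    length (trim v ++ replicate l 0) ≡⟨ length-split (trim v) l ⟩
    length (trim v) + l           ∎)
    where open ≡-Reasoning

pad : ℕ → List ℕ → List ℕ
pad L u = u ++ replicate (L ∸ length u) 0

length-pad : ∀ {L} u → length u ≤ L → length (pad L u) ≡ L
length-pad u |u|≤L = trans (length-++ u) (trans (cong (length u +_) (length-replicate _)) (m+[n∸m]≡n |u|≤L))

pad-length : ∀ {L} u → length u ≡ L → pad L u ≡ u
pad-length u refl = trans (cong (λ n → u ++ replicate n 0) (n∸n≡0 (length u))) (++-identityʳ u)

pad-suc : ∀ {L} u → length u ≤ L → pad (suc L) u ≡ pad L u ∷ʳ 0
pad-suc {L} u |u|≤L = begin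
  u ++ replicate (suc L ∸ length u) 0   ≡⟨ cong (λ n → u ++ replicate n 0) (+-∸-assoc 1 |u|≤L) ⟩
  u ++ replicate (suc (L ∸ length u)) 0 ≡⟨ cong (u ++_) (replicate-∷ʳ (L ∸ length u) 0) ⟨
  u ++ (replicate (L ∸ length u) 0 ∷ʳ 0) ≡⟨ ++-assoc u _ _ ⟨
  pad L u ∷ʳ 0                          ∎
  where open ≡-Reasoning

trim-pad : ∀ L u → trim (pad L u) ≡ trim u
trim-pad L u = trim-++-zeros u (L ∸ length u)

pad-≡⇔trim-≡ : ∀ u v → length u ≤ length v → (pad (length v) u ≡ v ⇔ trim v ≡ trim u)
pad-≡⇔trim-≡ u v |u|≤|v| = mk⇔
  (λ pad≡v → trans (cong trim (sym pad≡v)) (trim-pad (length v) u))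
  (λ tv≡tu → trim-injective _ v (length-pad u |u|≤|v|) (trans (trim-pad (length v) u) (sym tv≡tu)))

Positive : List ℕ → Set
Positive = All (0 <_)

flat-++ : ∀ u v → flat (u ++ v) ≡ flat u ++ flat v
flat-++ [] v = refl
flat-++ (zero ∷ u) v = flat-++ u v
flat-++ (suc x ∷ u) v = cong (suc x ∷_) (flat-++ u v)

flat-zeros : ∀ k → flat (replicate k 0) ≡ []
flat-zeros zero = refl
flat-zeros (suc k) = flat-zeros k

flat≡[]⇒zeros : ∀ u → flat u ≡ [] → u ≡ replicate (length u) 0
flat≡[]⇒zeros [] _ = refl
flat≡[]⇒zeros (zero ∷ u) flat≡[] = cong (0 ∷_) (flat≡[]⇒zeros u flat≡[])

flat-++-zeros : ∀ u k → flat (u ++ replicate k 0) ≡ flat u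
flat-++-zeros u k = trans (flat-++ u (replicate k 0)) (trans (cong (flat u ++_) (flat-zeros k)) (++-identityʳ _))

flat-∷ʳ-zero : ∀ u → flat (u ∷ʳ 0) ≡ flat u
flat-∷ʳ-zero u = flat-++-zeros u 1

flat-∷ʳ-suc : ∀ u x → flat (u ∷ʳ suc x) ≡ flat u ∷ʳ suc x
flat-∷ʳ-suc u x = flat-++ u [ suc x ]

flat-zeros× : ∀ m a → flat ((zeros× m) a) ≡ flat a
flat-zeros× m a = trans (flat-++ (replicate m 0) a) (cong (_++ flat a) (flat-zeros m))

flat-Positive : ∀ u → Positive (flat u)
flat-Positive [] = []
flat-Positive (zero ∷ u) = flat-Positive u
flat-Positive (suc x ∷ u) = s≤s z≤n ∷ flat-Positive u

sum-flat : ∀ u → sum (flat u) ≡ sum u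
sum-flat [] = refl
sum-flat (zero ∷ u) = sum-flat u
sum-flat (suc x ∷ u) = cong (suc x +_) (sum-flat u)

sum-pad : ∀ L u → sum (pad L u) ≡ sum u
sum-pad L u = trans (sym (sum-flat (pad L u))) (trans (cong sum (flat-++-zeros u _)) (sum-flat u))

sum-zeros× : ∀ m a → sum ((zeros× m) a) ≡ sum a
sum-zeros× m a = trans (sym (sum-flat ((zeros× m) a))) (trans (cong sum (flat-zeros× m a)) (sum-flat a))

-- Monomial quasisymmetric functions

⊕-identityʳ : ∀ u → u ⊕ [] ≡ u
⊕-identityʳ [] = refl
⊕-identityʳ (x ∷ u) = refl

⊕-assoc : ∀ u v w → (u ⊕ v) ⊕ w ≡ u ⊕ (v ⊕ w)
⊕-assoc [] v w = refl
⊕-assoc (x ∷ u) [] w = refl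
⊕-assoc (x ∷ u) (y ∷ v) [] = refl
⊕-assoc (x ∷ u) (y ∷ v) (z ∷ w) = cong₂ _∷_ (+-assoc x y z) (⊕-assoc u v w)

foldr-⊕ : ∀ z us → foldr _⊕_ z us ≡ foldr _⊕_ [] us ⊕ z
foldr-⊕ z [] = refl
foldr-⊕ z (u ∷ us) = trans (cong (u ⊕_) (foldr-⊕ z us)) (sym (⊕-assoc u (foldr _⊕_ [] us) z))

length-⊕-≤ : ∀ {L} u v → length u ≤ L → length v ≤ L → length (u ⊕ v) ≤ L
length-⊕-≤ [] v _ |v|≤L = |v|≤L
length-⊕-≤ (x ∷ u) [] |u|≤L _ = |u|≤L
length-⊕-≤ (x ∷ u) (y ∷ v) (s≤s |u|≤L) (s≤s |v|≤L) = s≤s (length-⊕-≤ u v |u|≤L |v|≤L)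

⊕-zeros-++ : ∀ {L} u w → length u ≤ L → u ⊕ (replicate L 0 ++ w) ≡ pad L u ++ w
⊕-zeros-++ [] w _ = refl
⊕-zeros-++ (x ∷ u) w (s≤s |u|≤L) = cong₂ _∷_ (+-identityʳ x) (⊕-zeros-++ u w |u|≤L)

InRange : ℕ → List ℕ → Set
InRange L = All (λ i → 1 ≤ i × i ≤ L)

InRange-suc : ∀ {L is} → InRange L is → InRange (suc L) is
InRange-suc = All.map (map₂ m≤n⇒m≤1+n)

length-monoOf : ∀ {L} is α → InRange L is → length (monoOf is α) ≤ L
length-monoOf [] α _ = z≤n
length-monoOf (i ∷ is) [] _ = z≤n
length-monoOf (suc i ∷ is) (e ∷ α) ((_ , i<L) ∷ range) =
  length-⊕-≤ (varPow (suc i) e) (monoOf is α) (subst (_≤ _) (sym |varPow|) i<L) (length-monoOf is α range)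
  where
  |varPow| : length (replicate i 0 ∷ʳ e) ≡ suc i
  |varPow| = trans (length-∷ʳ (replicate i 0) e) (cong suc (length-replicate i))

monoOf-∷ʳ : ∀ {L} is α e → length is ≡ length α → InRange L is →
  monoOf (is ∷ʳ suc L) (α ∷ʳ e) ≡ pad L (monoOf is α) ∷ʳ e
monoOf-∷ʳ {L} is α e |is|≡|α| range = begin
  foldr _⊕_ [] (zipWith varPow (is ∷ʳ suc L) (α ∷ʳ e))
    ≡⟨ cong (foldr _⊕_ []) (zipWith-∷ʳ varPow is α (suc L) e |is|≡|α|) ⟩
  foldr _⊕_ [] (zipWith varPow is α ∷ʳ varPow (suc L) e)
    ≡⟨ foldr-++ _⊕_ [] (zipWith varPow is α) _ ⟩
  foldr _⊕_ (varPow (suc L) e ⊕ []) (zipWith varPow is α)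
    ≡⟨ foldr-⊕ _ (zipWith varPow is α) ⟩
  monoOf is α ⊕ (varPow (suc L) e ⊕ [])
    ≡⟨ cong (monoOf is α ⊕_) (⊕-identityʳ _) ⟩
  monoOf is α ⊕ (replicate L 0 ++ [ e ])
    ≡⟨ ⊕-zeros-++ (monoOf is α) [ e ] (length-monoOf is α range) ⟩
  pad L (monoOf is α) ∷ʳ e ∎
  where open ≡-Reasoning

incr-zero : ∀ L → incr L 0 ≡ [ [] ]
incr-zero zero = refl
incr-zero (suc L) = incr-zero L

incr-InRange : ∀ L ℓ → All (λ is → length is ≡ ℓ × InRange L is) (incr L ℓ)
incr-InRange zero zero = (refl , []) ∷ []
incr-InRange zero (suc ℓ) = []
incr-InRange (suc L) zero = All.map (map₂ InRange-suc) (incr-InRange L zero)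
incr-InRange (suc L) (suc ℓ) =
  All.++⁺ (All.map (map₂ InRange-suc) (incr-InRange L (suc ℓ)))
          (All.map⁺ (All.map extend (incr-InRange L ℓ)))
  where
  extend : ∀ {is} → length is ≡ ℓ × InRange L is →
    length (is ∷ʳ suc L) ≡ suc ℓ × InRange (suc L) (is ∷ʳ suc L)
  extend {is} (|is|≡ℓ , range) =
    trans (length-∷ʳ is (suc L)) (cong suc |is|≡ℓ) , All.∷ʳ⁺ (InRange-suc range) (s≤s z≤n , ≤-refl)

-- The exponent vectors, padded to length L, of the monomials of M_α(x₁,…,x_L).
monomials : ℕ → List ℕ → List (List ℕ)
monomials L α = map (λ is → pad L (monoOf is α)) (incr L (length α))

-- Splitting by the exponent of x_{L+1}: M_{(α,e)}(x₁,…,x_{L+1}) = M_{(α,e)}(x₁,…,x_L) + M_α(x₁,…,x_L)·x_{L+1}^e.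
monomials-suc : ∀ L α e → monomials (suc L) (α ∷ʳ e) ≡
  map (_∷ʳ 0) (monomials L (α ∷ʳ e)) ++ map (_∷ʳ e) (monomials L α)
monomials-suc L α e rewrite length-∷ʳ α e = begin
  map term (incr L (suc ℓ) ++ map (_∷ʳ suc L) (incr L ℓ))
    ≡⟨ map-++ term (incr L (suc ℓ)) _ ⟩
  map term (incr L (suc ℓ)) ++ map term (map (_∷ʳ suc L) (incr L ℓ))
    ≡⟨ cong₂ _++_ without-x_L with-x_L ⟩
  map (_∷ʳ 0) (map (λ is → pad L (monoOf is (α ∷ʳ e))) (incr L (suc ℓ))) ++
  map (_∷ʳ e) (map (λ is → pad L (monoOf is α)) (incr L ℓ)) ∎
  where
  open ≡-Reasoning
  ℓ = length α
  term = λ is → pad (suc L) (monoOf is (α ∷ʳ e))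
  without-x_L : map term (incr L (suc ℓ)) ≡ map (_∷ʳ 0) (map (λ is → pad L (monoOf is (α ∷ʳ e))) (incr L (suc ℓ)))
  without-x_L = trans (map-cong-local (All.map (λ { {is} (_ , range) →
                                                      pad-suc (monoOf is (α ∷ʳ e)) (length-monoOf is (α ∷ʳ e) range) })
                                                 (incr-InRange L (suc ℓ))))
                      (map-∘ (incr L (suc ℓ)))
  last : ∀ {is} → length is ≡ ℓ × InRange L is → term (is ∷ʳ suc L) ≡ pad L (monoOf is α) ∷ʳ e
  last {is} (|is|≡ℓ , range) = begin
    pad (suc L) (monoOf (is ∷ʳ suc L) (α ∷ʳ e)) ≡⟨ cong (pad (suc L)) monoOf≡ ⟩
    pad (suc L) (pad L (monoOf is α) ∷ʳ e)     ≡⟨ pad-length _ |monoOf| ⟩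
    pad L (monoOf is α) ∷ʳ e                   ∎
    where
    monoOf≡ = monoOf-∷ʳ is α e |is|≡ℓ range
    |monoOf| = trans (length-∷ʳ (pad L (monoOf is α)) e) (cong suc (length-pad (monoOf is α) (length-monoOf is α range)))
  with-x_L : map term (map (_∷ʳ suc L) (incr L ℓ)) ≡ map (_∷ʳ e) (map (λ is → pad L (monoOf is α)) (incr L ℓ))
  with-x_L = trans (sym (map-∘ (incr L ℓ))) (trans (map-cong-local (All.map last (incr-InRange L ℓ))) (map-∘ (incr L ℓ)))

occ-map-∷ʳ : ∀ v x xs → occ (v ∷ʳ x) (map (_∷ʳ x) xs) ≡ occ v xs
occ-map-∷ʳ v x xs = occ-map-injective (_∷ʳ x) (λ {u} {w} → ∷ʳ-injectiveˡ u w) v xs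

occ-map-∷ʳ-≢ : ∀ {x y} v xs → x ≢ y → occ (v ∷ʳ x) (map (_∷ʳ y) xs) ≡ 0
occ-map-∷ʳ-≢ v xs x≢y =
  occ-map-outside (_∷ʳ _) (λ w w∷ʳy≡v∷ʳx → x≢y (sym (∷ʳ-injectiveʳ w v w∷ʳy≡v∷ʳx))) xs

occ-monomials-[] : ∀ L c → length c ≡ L → occ c (monomials L []) ≡ occ (flat c) [ [] ]
occ-monomials-[] L c |c|≡L rewrite incr-zero L = by-cases (flat c ≟ₗ [])
  where
  by-cases : Dec (flat c ≡ []) → occ c [ replicate L 0 ] ≡ occ (flat c) [ [] ]
  by-cases (yes flat≡[]) = trans (occ-[-]-≡ c _ c≡zeros) (sym (occ-[-]-≡ (flat c) [] flat≡[]))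
    where
    c≡zeros : c ≡ replicate L 0
    c≡zeros = trans (flat≡[]⇒zeros c flat≡[]) (cong (λ n → replicate n 0) |c|≡L)
  by-cases (no flat≢[]) =
    trans (occ-[-]-≢ c (replicate L 0) (λ c≡zeros → flat≢[] (trans (cong flat c≡zeros) (flat-zeros L))))
          (sym (occ-[-]-≢ (flat c) [] flat≢[]))

occ-monomials : ∀ L α c → Positive α → length c ≡ L → occ c (monomials L α) ≡ occ (flat c) [ α ]

occ-monomials-∷ʳ : ∀ L α e c → Positive (α ∷ʳ e) → length c ≡ L →
  occ c (monomials L (α ∷ʳ e)) ≡ occ (flat c) [ α ∷ʳ e ]
occ-monomials-∷ʳ zero α e [] pos refl rewrite length-∷ʳ α e =
  sym (occ-[-]-≢ [] (α ∷ʳ e) (∷ʳ≢[] α e ∘ sym))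
occ-monomials-∷ʳ zero α e (_ ∷ _) pos ()
occ-monomials-∷ʳ (suc L) α e c pos |c|≡ with initLast c
occ-monomials-∷ʳ (suc L) α e .[] pos () | []
occ-monomials-∷ʳ (suc L) α e .(c ∷ʳ x) pos |c∷ʳx|≡ | c ∷ʳ′ x = begin
  occ (c ∷ʳ x) (monomials (suc L) (α ∷ʳ e))
    ≡⟨ cong (occ (c ∷ʳ x)) (monomials-suc L α e) ⟩
  occ (c ∷ʳ x) (map (_∷ʳ 0) M₁ ++ map (_∷ʳ e) M₀)
    ≡⟨ length-filter-++ ((c ∷ʳ x) ≟ₗ_) (map (_∷ʳ 0) M₁) (map (_∷ʳ e) M₀) ⟩
  occ (c ∷ʳ x) (map (_∷ʳ 0) M₁) + occ (c ∷ʳ x) (map (_∷ʳ e) M₀)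
    ≡⟨ by-exponent-of-x_L x ⟩
  occ (flat (c ∷ʳ x)) [ α ∷ʳ e ] ∎
  where
  open ≡-Reasoning
  M₁ = monomials L (α ∷ʳ e)
  M₀ = monomials L α
  |c|≡L : length c ≡ L
  |c|≡L = suc-injective (trans (sym (length-∷ʳ c x)) |c∷ʳx|≡)
  e>0 : 0 < e
  e>0 = proj₂ (All.∷ʳ⁻ pos)
  by-exponent-of-x_L : ∀ x → occ (c ∷ʳ x) (map (_∷ʳ 0) M₁) + occ (c ∷ʳ x) (map (_∷ʳ e) M₀) ≡
                             occ (flat (c ∷ʳ x)) [ α ∷ʳ e ]
  by-exponent-of-x_L zero = begin
    occ (c ∷ʳ 0) (map (_∷ʳ 0) M₁) + occ (c ∷ʳ 0) (map (_∷ʳ e) M₀)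
      ≡⟨ cong₂ _+_ (occ-map-∷ʳ c 0 M₁) (occ-map-∷ʳ-≢ c M₀ (λ 0≡e → <-irrefl 0≡e e>0)) ⟩
    occ c M₁ + 0                     ≡⟨ +-identityʳ _ ⟩
    occ c M₁                         ≡⟨ occ-monomials-∷ʳ L α e c pos |c|≡L ⟩
    occ (flat c) [ α ∷ʳ e ]          ≡⟨ cong (λ u → occ u [ α ∷ʳ e ]) (flat-∷ʳ-zero c) ⟨
    occ (flat (c ∷ʳ 0)) [ α ∷ʳ e ]   ∎
  by-exponent-of-x_L (suc x) with suc x ≟ e
  ... | yes x≡e = begin
    occ (c ∷ʳ suc x) (map (_∷ʳ 0) M₁) + occ (c ∷ʳ suc x) (map (_∷ʳ e) M₀)
      ≡⟨ cong₂ _+_ (occ-map-∷ʳ-≢ c M₁ (λ ())) (cong (λ y → occ (c ∷ʳ y) (map (_∷ʳ e) M₀)) x≡e) ⟩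
    occ (c ∷ʳ e) (map (_∷ʳ e) M₀)      ≡⟨ occ-map-∷ʳ c e M₀ ⟩
    occ c M₀                           ≡⟨ occ-monomials L α c (proj₁ (All.∷ʳ⁻ pos)) |c|≡L ⟩
    occ (flat c) [ α ]                 ≡⟨ occ-map-∷ʳ (flat c) e [ α ] ⟨
    occ (flat c ∷ʳ e) [ α ∷ʳ e ]        ≡⟨ cong (λ y → occ (flat c ∷ʳ y) [ α ∷ʳ e ]) x≡e ⟨
    occ (flat c ∷ʳ suc x) [ α ∷ʳ e ]    ≡⟨ cong (λ u → occ u [ α ∷ʳ e ]) (flat-∷ʳ-suc c x) ⟨
    occ (flat (c ∷ʳ suc x)) [ α ∷ʳ e ] ∎
  ... | no x≢e = begin
    occ (c ∷ʳ suc x) (map (_∷ʳ 0) M₁) + occ (c ∷ʳ suc x) (map (_∷ʳ e) M₀)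
      ≡⟨ cong₂ _+_ (occ-map-∷ʳ-≢ c M₁ (λ ())) (occ-map-∷ʳ-≢ c M₀ x≢e) ⟩
    0                                  ≡⟨ occ-map-∷ʳ-≢ (flat c) [ α ] x≢e ⟨
    occ (flat c ∷ʳ suc x) [ α ∷ʳ e ]    ≡⟨ cong (λ u → occ u [ α ∷ʳ e ]) (flat-∷ʳ-suc c x) ⟨
    occ (flat (c ∷ʳ suc x)) [ α ∷ʳ e ] ∎

occ-monomials L α c pos |c|≡L with initLast α
... | [] = occ-monomials-[] L c |c|≡L
... | α′ ∷ʳ′ e = occ-monomials-∷ʳ L α′ e c pos |c|≡L

coeffM-flat : ∀ α c → Positive α → coeffM α c ≡ occ (flat c) [ α ]
coeffM-flat α c pos = begin
  coeffM α c
    ≡⟨ length-filter-map (λ b → trim b ≟ₗ trim c) (λ is → monoOf is α) I ⟩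
  length (filter (λ is → trim (monoOf is α) ≟ₗ trim c) I)
    ≡⟨ length-filter-cong _ _ (All.map same-monomial (incr-InRange L (length α))) ⟩
  length (filter (λ is → c ≟ₗ pad L (monoOf is α)) I)
    ≡⟨ length-filter-map (c ≟ₗ_) (λ is → pad L (monoOf is α)) I ⟨
  occ c (monomials L α)
    ≡⟨ occ-monomials L α c pos refl ⟩
  occ (flat c) [ α ] ∎
  where
  open ≡-Reasoning
  L = length c
  I = incr L (length α)
  same-monomial : ∀ {is} → length is ≡ length α × InRange L is →
    (trim (monoOf is α) ≡ trim c ⇔ c ≡ pad L (monoOf is α))
  same-monomial {is} (_ , range) = mk⇔ (sym ∘ from ∘ sym) (sym ∘ to ∘ sym)
    where open Equivalence (pad-≡⇔trim-≡ (monoOf is α) c (length-monoOf is α range))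

-- Weak compositions, compositions and refinements

wcomps-length-sum : ∀ N k → All (λ b → length b ≡ N × sum b ≡ k) (wcomps N k)
wcomps-length-sum zero zero = (refl , refl) ∷ []
wcomps-length-sum zero (suc k) = []
wcomps-length-sum (suc N) k =
  All.concat⁺ (All.map⁺ (All.tabulate (λ i∈ → All.map⁺ (All.map (λ {b} → prepend i∈ {b}) (wcomps-length-sum N _)))))
  where
  prepend : ∀ {i} → i ∈ upTo (suc k) → ∀ {b} → length b ≡ N × sum b ≡ k ∸ i →
    length (i ∷ b) ≡ suc N × sum (i ∷ b) ≡ k
  prepend {i} i∈ (|b|≡N , sum≡) = cong suc |b|≡N , trans (cong (i +_) sum≡) (m+[n∸m]≡n (≤-pred (∈-upTo⁻ i∈)))

occ-wcomps : ∀ v → occ v (wcomps (length v) (sum v)) ≡ 1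
occ-wcomps [] = refl
occ-wcomps (x ∷ v) = begin
  occ (x ∷ v) (wcomps (suc (length v)) k)
    ≡⟨ occ-concatMap-tagged ℕ._≟_ _≟ₗ_ (fromMaybe 0 ∘ head) _ (upTo (suc k)) tagged (x ∷ v) ⟩
  ℕ-Multiplicity.occ x (upTo (suc k)) * occ (x ∷ v) (map (x ∷_) (wcomps (length v) (k ∸ x)))
    ≡⟨ cong₂ _*_ (ℕ-Multiplicity.occ-unique (upTo⁺ (suc k)) (∈-upTo⁺ (s≤s (m≤m+n x (sum v)))))
                 (occ-map-injective (x ∷_) ∷-injectiveʳ v (wcomps (length v) (k ∸ x))) ⟩
  1 * occ v (wcomps (length v) (k ∸ x))
    ≡⟨ cong (λ s → 1 * occ v (wcomps (length v) s)) (m+n∸m≡n x (sum v)) ⟩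
  1 * occ v (wcomps (length v) (sum v))
    ≡⟨ cong (1 *_) (occ-wcomps v) ⟩
  1 ∎
  where
  open ≡-Reasoning
  k = x + sum v
  tagged : All (λ i → All (λ b → fromMaybe 0 (head b) ≡ i) (map (i ∷_) (wcomps (length v) (k ∸ i)))) (upTo (suc k))
  tagged = All.universal (λ i → All.map⁺ (All.universal (λ _ → refl) _)) _

occ-wcomps-≤1 : ∀ N k v → occ v (wcomps N k) ≤ 1
occ-wcomps-≤1 N k = occ-≤1-from-members member-once
  where
  member-once : ∀ {v} → v ∈ wcomps N k → occ v (wcomps N k) ≤ 1
  member-once {v} v∈ with All.lookup (wcomps-length-sum N k) v∈
  ... | refl , refl = ≤-reflexive (occ-wcomps v)

comps-sum-Positive : ∀ p → All (λ γ → sum γ ≡ p × Positive γ) (comps p)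
comps-sum-Positive p = All.zip (All.filter⁺ (all? (0 <?_)) sums , All.all-filter (all? (0 <?_)) W)
  where
  W = concatMap (λ L → wcomps L p) (upTo (suc p))
  sums : All (λ γ → sum γ ≡ p) W
  sums = All.concat⁺ (All.map⁺ (All.universal (λ L → All.map proj₂ (wcomps-length-sum L p)) (upTo (suc p))))

occ-comps-≤1 : ∀ p γ → occ γ (comps p) ≤ 1
occ-comps-≤1 p γ = begin
  occ γ (comps p)
    ≤⟨ occ-filter-≤ (all? (0 <?_)) γ (concatMap (λ L → wcomps L p) (upTo (suc p))) ⟩
  occ γ (concatMap (λ L → wcomps L p) (upTo (suc p)))
    ≡⟨ occ-concatMap-tagged ℕ._≟_ _≟ₗ_ length _ (upTo (suc p)) tagged γ ⟩
  ℕ-Multiplicity.occ (length γ) (upTo (suc p)) * occ γ (wcomps (length γ) p)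
    ≤⟨ *-mono-≤ (ℕ-Multiplicity.occ-unique-≤1 (upTo⁺ (suc p)) (length γ)) (occ-wcomps-≤1 (length γ) p γ) ⟩
  1 ∎
  where
  open ≤-Reasoning
  tagged = All.universal (λ L → All.map proj₁ (wcomps-length-sum L p)) (upTo (suc p))

-- The first block of β when β refines a composition whose first part is p.
firstBlock : ℕ → List ℕ → List ℕ
firstBlock zero β = []
firstBlock (suc p) [] = []
firstBlock (suc p) (x ∷ β) = x ∷ firstBlock (suc p ∸ x) β

firstBlock-++ : ∀ γ ρ → Positive γ → firstBlock (sum γ) (γ ++ ρ) ≡ γ
firstBlock-++ [] ρ _ = refl
firstBlock-++ (suc x ∷ γ) ρ (_ ∷ pos) =
  cong (suc x ∷_) (trans (cong (λ q → firstBlock q (γ ++ ρ)) (m+n∸m≡n x (sum γ))) (firstBlock-++ γ ρ pos))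

refinementsOf-sum-Positive : ∀ α → All (λ β → sum β ≡ sum α × Positive β) (refinementsOf α)
refinementsOf-sum-Positive [] = (refl , []) ∷ []
refinementsOf-sum-Positive (p ∷ α) =
  All.concat⁺ (All.map⁺ (All.map (λ γ-ok → All.map⁺ (All.map (join γ-ok) (refinementsOf-sum-Positive α)))
                                  (comps-sum-Positive p)))
  where
  join : ∀ {γ ρ} → sum γ ≡ p × Positive γ → sum ρ ≡ sum α × Positive ρ →
    sum (γ ++ ρ) ≡ p + sum α × Positive (γ ++ ρ)
  join {γ} {ρ} (sumγ , posγ) (sumρ , posρ) = trans (sum-++ γ ρ) (cong₂ _+_ sumγ sumρ) , All.++⁺ posγ posρ

occ-refinementsOf-≤1 : ∀ α β → occ β (refinementsOf α) ≤ 1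
occ-refinementsOf-≤1 [] β = length-filter (β ≟ₗ_) [ [] ]
occ-refinementsOf-≤1 (p ∷ α) β = begin
  occ β (refinementsOf (p ∷ α))
    ≡⟨ occ-concatMap-tagged _≟ₗ_ _≟ₗ_ (firstBlock p) _ (comps p) tagged β ⟩
  occ γ (comps p) * occ β (map (γ ++_) (refinementsOf α))
    ≤⟨ *-mono-≤ (occ-comps-≤1 p γ)
                (occ-map-≤1 (γ ++_) (++-cancelˡ γ _ _) {refinementsOf α} (occ-refinementsOf-≤1 α) β) ⟩
  1 ∎
  where
  open ≤-Reasoning
  γ = firstBlock p β
  block : ∀ {γ} → sum γ ≡ p × Positive γ → All (λ β → firstBlock p β ≡ γ) (map (γ ++_) (refinementsOf α))
  block {γ} (refl , posγ) = All.map⁺ (All.universal (λ ρ → firstBlock-++ γ ρ posγ) _)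
  tagged = All.map block (comps-sum-Positive p)

occ-refinementsOf : ∀ {α β} → β ∈ refinementsOf α → occ β (refinementsOf α) ≡ 1
occ-refinementsOf {α} {β} β∈ = ≤-antisym (occ-refinementsOf-≤1 α β) (occ-∈ β∈)

coeffF-flat : ∀ α c → coeffF α c ≡ occ (flat c) (refinementsOf α)
coeffF-flat α c = begin
  sum (map (λ β → coeffM β c) R)
    ≡⟨ cong sum (map-cong-local (All.map (λ { {β} (_ , pos) → coeffM-flat β c pos }) (refinementsOf-sum-Positive α))) ⟩
  sum (map (λ β → occ (flat c) [ β ]) R)
    ≡⟨ length-filter-concatMap (flat c ≟ₗ_) [_] R ⟨
  occ (flat c) (concatMap [_] R)
    ≡⟨ cong (occ (flat c)) (concatMap-pure R) ⟩
  occ (flat c) R ∎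
  where
  open ≡-Reasoning
  R = refinementsOf α

-- Slide polynomials of 0^m × a

sum-take-≤ : ∀ i w → sum (take i w) ≤ sum w
sum-take-≤ zero w = z≤n
sum-take-≤ (suc i) [] = z≤n
sum-take-≤ (suc i) (x ∷ w) = +-monoʳ-≤ x (sum-take-≤ i w)

sum-take-zeros : ∀ i m w → i ≤ m → sum (take i ((zeros× m) w)) ≡ 0
sum-take-zeros zero m w _ = refl
sum-take-zeros (suc i) (suc m) w (s≤s i≤m) = sum-take-zeros i m w i≤m

sum-≤-take-++ : ∀ u w i → length u ≤ i → sum u ≤ sum (take i (u ++ w))
sum-≤-take-++ [] w i _ = z≤n
sum-≤-take-++ (x ∷ u) w (suc i) (s≤s |u|≤i) = +-monoʳ-≤ x (sum-≤-take-++ u w i |u|≤i)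

pad-dominates-zeros× : ∀ m a c → length c ≤ m → sum c ≡ sum a →
  Dom (pad (length ((zeros× m) a)) c) ((zeros× m) a)
pad-dominates-zeros× m a c |c|≤m sum≡ = All.universal partial-sums _
  where
  a′ = (zeros× m) a
  c′ = pad (length a′) c
  partial-sums : ∀ i → sum (take i a′) ≤ sum (take i c′)
  partial-sums i with i ≤? m
  ... | yes i≤m = ≤-trans (≤-reflexive (sum-take-zeros i m a i≤m)) z≤n
  ... | no i≰m = begin
    sum (take i a′) ≤⟨ sum-take-≤ i a′ ⟩
    sum a′          ≡⟨ sum-zeros× m a ⟩
    sum a           ≡⟨ sum≡ ⟨
    sum c           ≤⟨ sum-≤-take-++ c _ i (≤-trans |c|≤m (<⇒≤ (≰⇒> i≰m))) ⟩
    sum (take i c′) ∎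
    where open ≤-Reasoning

coeff-filter-wcomps : ∀ {P : List ℕ → Set} (P? : Decidable P) N k c → length c ≤ N →
  coeff (filter P? (wcomps N k)) c ≡ occ (pad N c) (filter P? (wcomps N k))
coeff-filter-wcomps P? N k c |c|≤N =
  length-filter-cong _ _ (All.filter⁺ P? (All.map same-vector (wcomps-length-sum N k)))
  where
  same-vector : ∀ {b} → length b ≡ N × sum b ≡ k → (trim b ≡ trim c ⇔ pad N c ≡ b)
  same-vector {b} (refl , _) = mk⇔ from to
    where open Equivalence (pad-≡⇔trim-≡ c b |c|≤N)

module _ (m : ℕ) (a c : List ℕ) (|c|≤m : length c ≤ m) where

  private
    a′ = (zeros× m) a
    N = length a′
    c′ = pad N c

    |c|≤N : length c ≤ N
    |c|≤N = ≤-trans |c|≤m (≤-trans (m≤m+n m (length a)) (≤-reflexive (sym |a′|)))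
      where
      |a′| : length a′ ≡ m + length a
      |a′| = trans (length-++ (replicate m 0)) (cong (_+ length a) (length-replicate m))

    occ-pad-accepted : ∀ {Q} (Q? : Decidable Q) → sum c ≡ sum a → Q c′ →
      occ c′ (filter (λ b → dom? b a′ ×-dec Q? b) (wcomps N (sum a′))) ≡ 1
    occ-pad-accepted Q? sum≡ q = begin
      occ c′ (filter (λ b → dom? b a′ ×-dec Q? b) (wcomps N (sum a′)))
        ≡⟨ occ-filter-accept _ (wcomps N (sum a′)) (pad-dominates-zeros× m a c |c|≤m sum≡ , q) ⟩
      occ c′ (wcomps N (sum a′))
        ≡⟨ cong₂ (λ n s → occ c′ (wcomps n s)) (length-pad c |c|≤N) sum-c′ ⟨
      occ c′ (wcomps (length c′) (sum c′))
        ≡⟨ occ-wcomps c′ ⟩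
      1 ∎
      where
      open ≡-Reasoning
      sum-c′ : sum c′ ≡ sum a′
      sum-c′ = trans (sum-pad N c) (trans sum≡ (sym (sum-zeros× m a)))

    flat-c′ : flat c′ ≡ flat c
    flat-c′ = flat-++-zeros c (N ∸ length c)

  coeff-𝔐-zeros× : coeff (𝔐 ((zeros× m) a)) c ≡ occ (flat c) [ flat a ]
  coeff-𝔐-zeros× = trans (coeff-filter-wcomps _ N (sum a′) c |c|≤N) (by-cases (flat c ≟ₗ flat a))
    where
    by-cases : Dec (flat c ≡ flat a) → occ c′ (𝔐 a′) ≡ occ (flat c) [ flat a ]
    by-cases (yes fc≡fa) =
      trans (occ-pad-accepted (λ b → flat b ≟ₗ flat a′) sum≡ (trans flat-c′ (trans fc≡fa (sym (flat-zeros× m a)))))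
            (sym (occ-[-]-≡ (flat c) (flat a) fc≡fa))
      where
      sum≡ : sum c ≡ sum a
      sum≡ = trans (sym (sum-flat c)) (trans (cong sum fc≡fa) (sum-flat a))
    by-cases (no fc≢fa) =
      trans (occ-filter-reject _ (wcomps N (sum a′))
               (λ (_ , fc′≡fa′) → fc≢fa (trans (sym flat-c′) (trans fc′≡fa′ (flat-zeros× m a)))))
            (sym (occ-[-]-≢ (flat c) (flat a) fc≢fa))

  coeff-𝔉-zeros× : coeff (𝔉 ((zeros× m) a)) c ≡ occ (flat c) (refinementsOf (flat a))
  coeff-𝔉-zeros× = trans (coeff-filter-wcomps _ N (sum a′) c |c|≤N) (by-cases (refines? (flat c) (flat a)))
    where
    refines-a′ : ∀ {b} → Refines (flat b) (flat a′) ⇔ Refines (flat b) (flat a)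
    refines-a′ {b} = mk⇔ (subst (Refines (flat b)) (flat-zeros× m a))
                         (subst (Refines (flat b)) (sym (flat-zeros× m a)))
    by-cases : Dec (Refines (flat c) (flat a)) → occ c′ (𝔉 a′) ≡ occ (flat c) (refinementsOf (flat a))
    by-cases (yes fc≺fa) =
      trans (occ-pad-accepted (λ b → refines? (flat b) (flat a′)) sum≡
                              (Equivalence.from (refines-a′ {c′}) (subst (λ β → Refines β (flat a)) (sym flat-c′) fc≺fa)))
            (sym (occ-refinementsOf {flat a} fc≺fa))
      where
      sum≡ : sum c ≡ sum a
      sum≡ = trans (sym (sum-flat c)) (trans (proj₁ (All.lookup (refinementsOf-sum-Positive (flat a)) fc≺fa)) (sum-flat a))
    by-cases (no fc⊀fa) =
      trans (occ-filter-reject _ (wcomps N (sum a′))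
               (λ (_ , fc′≺fa′) →
                  fc⊀fa (subst (λ β → Refines β (flat a)) flat-c′ (Equivalence.to (refines-a′ {c′}) fc′≺fa′))))
            (sym (occ-∉ fc⊀fa))

theorem4p5 : (a : List ℕ) →
    ((c : List ℕ) → Σ ℕ (λ m₀ → (m : ℕ) → m₀ ≤ m → coeff (𝔐 ((zeros× m) a)) c ≡ coeffM (flat a) c))
    × ((c : List ℕ) → Σ ℕ (λ m₀ → (m : ℕ) → m₀ ≤ m → coeff (𝔉 ((zeros× m) a)) c ≡ coeffF (flat a) c))
theorem4p5 a =
  (λ c → length c , λ m |c|≤m → trans (coeff-𝔐-zeros× m a c |c|≤m) (sym (coeffM-flat (flat a) c (flat-Positive a)))) ,
  (λ c → length c , λ m |c|≤m → trans (coeff-𝔉-zeros× m a c |c|≤m) (sym (coeffF-flat (flat a) c)))
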